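{- For every $n\ge1$, the maximally balanced tree $T^{mb}_n$ with $n$ leaves has minimal Colless index, i.e. $\mathcal{C}(T^{mb}_n)=c_n$, where $c_n$ is the minimum of the Colless index over all rooted binary trees with $n$ leaves.
   Context: A rooted binary tree with $n\ge2$ leaves is a rooted tree in which the root has degree 2 and every other internal vertex has degree 3 (each internal vertex has exactly two children); the single vertex is the rooted binary tree with one leaf. For a vertex $v$, $\kappa_T(v)$ is the number of leaves descending from $v$ ($1$ if $v$ is a leaf). For an internal vertex $v$ with children $v_1,v_2$, $bal_T(v)=|\kappa_T(v_1)-\kappa_T(v_2)|$, and the Colless index is $\mathcal{C}(T)=\sum_{v\text{ internal}} bal_T(v)$. A rooted binary tree is maximally balanced if $bal_T(v)\le1$ for every internal vertex $v$; for each $n$ there is a unique (up to isomorphism) maximally balanced tree $T^{mb}_n$ with $n$ leaves (its root splits the leaves into $\lceil n/2\rceil$ and $\lfloor n/2\rfloor$, and both subtrees are again maximally balanced). -}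

module Defs where

open import Data.Nat using (ℕ; suc; _+_; _≤_)
open import Data.Integer using (∣_∣; _-_; +_)
open import Data.Product using (_×_)
open import Relation.Binary.PropositionalEquality using (_≡_)

-- Rooted binary trees (unlabelled, up to the left/right order of children,
-- which does not affect any quantity below).
data Tree : Set where
  leaf : Tree
  node : Tree → Tree → Tree

leaves : Tree → ℕ
leaves leaf = 1
leaves (node l r) = leaves l + leaves r

bal : Tree → Tree → ℕ
bal l r = ∣ + leaves l - + leaves r ∣

colless : Tree → ℕ
colless leaf = 0
colless (node l r) = bal l r + colless l + colless r

data MaxBal : Tree → Set where
  mb-leaf : MaxBal leaf
  mb-node : ∀ {l r} → bal l r ≤ 1 → MaxBal l → MaxBal r → MaxBal (node l r)

MinColless : ℕ → Tree → Set
MinColless n T = leaves T ≡ n × (∀ (T' : Tree) → leaves T' ≡ n → colless T ≤ colless T')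

-- Let c n (collessMB n) be the Colless index of the maximally balanced tree with n leaves, so
-- that c (a + b) = ∣ a - b ∣ + c a + c b whenever ∣ a - b ∣ ≤ 1.  The heart of the proof is the
-- inequality c (a + b) ≤ ∣ a - b ∣ + c a + c b for all a and b, by strong induction on a + b:
-- writing a = i + p + p and b = j + q + q with i, j ≤ 1, the sum a + b splits into the
-- parts (i + p) + q and p + (j + q), which differ by at most one, and the induction
-- hypothesis applies to both.  Induction on trees then gives c (leaves T) ≤ colless T for
-- every tree T, with equality when T is maximally balanced.

module Submission where

open import Defs
open import Data.Nat using (ℕ; _≤_)
open import Relation.Binary.PropositionalEquality using (_≡_)

open import Data.Nat using (zero; suc; _+_; _<_; z≤n; s≤s; z<s; ∣_-_∣; ⌊_/2⌋; ⌈_/2⌉)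
open import Data.Nat.Induction using (<-wellFounded; <-rec)
open import Data.Nat.Properties
open import Algebra.Properties.CommutativeSemigroup +-commutativeSemigroup
  using (x∙yz≈y∙xz; xy∙z≈xz∙y)
open import Data.Nat.Tactic.RingSolver using (solve-∀)
open import Data.Product using (_,_)
open import Data.Sum using (_⊎_; inj₁; inj₂)
import Data.Integer as ℤ
import Data.Integer.Properties as ℤ
open import Induction.WellFounded using (module FixPoint)
open import Relation.Binary.PropositionalEquality
  using (refl; sym; trans; cong; cong₂; subst; subst₂; module ≡-Reasoning)

∣i+n-n∣≡i : ∀ i n → ∣ i + n - n ∣ ≡ i
∣i+n-n∣≡i i n =
  trans (∣-∣-comm (i + n) n) (trans (cong (λ m → ∣ n - m ∣) (+-comm i n)) (∣m-m+n∣≡n n i))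

∣i+m-j+m∣≡∣i-j∣ : ∀ i j m → ∣ i + m - j + m ∣ ≡ ∣ i - j ∣
∣i+m-j+m∣≡∣i-j∣ i j m = trans (cong₂ ∣_-_∣ (+-comm i m) (+-comm j m)) (∣m+n-m+o∣≡∣n-o∣ m i j)

∣i-j∣≤1 : ∀ {i j} → i ≤ 1 → j ≤ 1 → ∣ i - j ∣ ≤ 1
∣i-j∣≤1 {i} {j} i≤1 j≤1 = ≤-trans (∣m-n∣≤m⊔n i j) (⊔-lub i≤1 j≤1)

∣m+m-n+n∣≡∣m-n∣+∣m-n∣ : ∀ m n → ∣ m + m - n + n ∣ ≡ ∣ m - n ∣ + ∣ m - n ∣
∣m+m-n+n∣≡∣m-n∣+∣m-n∣ zero    n       = refl
∣m+m-n+n∣≡∣m-n∣+∣m-n∣ (suc m) zero    = refl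
∣m+m-n+n∣≡∣m-n∣+∣m-n∣ (suc m) (suc n) rewrite +-suc m m | +-suc n n =
  ∣m+m-n+n∣≡∣m-n∣+∣m-n∣ m n

∣1+m+m-n+n∣≡∣1+m-n∣+∣m-n∣ : ∀ m n → ∣ suc (m + m) - n + n ∣ ≡ ∣ suc m - n ∣ + ∣ m - n ∣
∣1+m+m-n+n∣≡∣1+m-n∣+∣m-n∣ zero    zero    = refl
∣1+m+m-n+n∣≡∣1+m-n∣+∣m-n∣ zero    (suc n) = refl
∣1+m+m-n+n∣≡∣1+m-n∣+∣m-n∣ (suc m) zero    = refl
∣1+m+m-n+n∣≡∣1+m-n∣+∣m-n∣ (suc m) (suc n) rewrite +-suc m m | +-suc n n =
  ∣1+m+m-n+n∣≡∣1+m-n∣+∣m-n∣ m n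

∣m-n∣≤1⇒m≡n⊎m≡1+n⊎n≡1+m : ∀ m n → ∣ m - n ∣ ≤ 1 → m ≡ n ⊎ m ≡ suc n ⊎ n ≡ suc m
∣m-n∣≤1⇒m≡n⊎m≡1+n⊎n≡1+m zero          zero          _         = inj₁ refl
∣m-n∣≤1⇒m≡n⊎m≡1+n⊎n≡1+m zero          (suc zero)    _         = inj₂ (inj₂ refl)
∣m-n∣≤1⇒m≡n⊎m≡1+n⊎n≡1+m zero          (suc (suc n)) (s≤s ())
∣m-n∣≤1⇒m≡n⊎m≡1+n⊎n≡1+m (suc zero)    zero          _         = inj₂ (inj₁ refl)
∣m-n∣≤1⇒m≡n⊎m≡1+n⊎n≡1+m (suc (suc m)) zero          (s≤s ())
∣m-n∣≤1⇒m≡n⊎m≡1+n⊎n≡1+m (suc m)       (suc n)       d≤1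
  with ∣m-n∣≤1⇒m≡n⊎m≡1+n⊎n≡1+m m n d≤1
... | inj₁ m≡n          = inj₁ (cong suc m≡n)
... | inj₂ (inj₁ m≡1+n) = inj₂ (inj₁ (cong suc m≡1+n))
... | inj₂ (inj₂ n≡1+m) = inj₂ (inj₂ (cong suc n≡1+m))

collessMB-step : ∀ n → (∀ {m} → m < n → ℕ) → ℕ
collessMB-step 0 _ = 0
collessMB-step 1 _ = 0
collessMB-step n@(suc (suc k)) c =
  ∣ ⌈ n /2⌉ - ⌊ n /2⌋ ∣ + c (⌈n/2⌉<n k) + c (⌊n/2⌋<n (suc k))

collessMB-step-ext : ∀ n {c c′ : ∀ {m} → m < n → ℕ} →
  (∀ {m} (m<n : m < n) → c m<n ≡ c′ m<n) → collessMB-step n c ≡ collessMB-step n c′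
collessMB-step-ext 0             _    = refl
collessMB-step-ext 1             _    = refl
collessMB-step-ext (suc (suc k)) c≗c′ = cong₂ _+_ (cong (_ +_) (c≗c′ _)) (c≗c′ _)

opaque
  collessMB : ℕ → ℕ
  collessMB = <-rec (λ _ → ℕ) collessMB-step

  collessMB-unfold : ∀ n → collessMB n ≡ collessMB-step n (λ {m} _ → collessMB m)
  collessMB-unfold n =
    FixPoint.unfold-wfRec <-wellFounded (λ _ → ℕ) collessMB-step collessMB-step-ext {n}

collessMB-zero : collessMB 0 ≡ 0
collessMB-zero = collessMB-unfold 0

collessMB-unfold-halves : ∀ {n a b} → 2 ≤ n → ⌈ n /2⌉ ≡ a → ⌊ n /2⌋ ≡ b →
  collessMB n ≡ ∣ a - b ∣ + collessMB a + collessMB b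
collessMB-unfold-halves {n} (s≤s (s≤s _)) refl refl = collessMB-unfold n

collessMB-join-equal : ∀ {a} → 1 ≤ a → collessMB (a + a) ≡ ∣ a - a ∣ + collessMB a + collessMB a
collessMB-join-equal {a} 1≤a =
  collessMB-unfold-halves (+-mono-≤ 1≤a 1≤a) (sym (n≡⌈n+n/2⌉ a)) (sym (n≡⌊n+n/2⌋ a))

collessMB-join-suc : ∀ {a} → 1 ≤ a →
  collessMB (suc a + a) ≡ ∣ suc a - a ∣ + collessMB (suc a) + collessMB a
collessMB-join-suc {a} 1≤a = collessMB-unfold-halves
  (s≤s (≤-trans 1≤a (m≤m+n a a))) (cong suc (sym (n≡⌊n+n/2⌋ a))) (sym (n≡⌈n+n/2⌉ a))

collessMB-join-comm : ∀ a b →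
  ∣ a - b ∣ + collessMB a + collessMB b ≡ ∣ b - a ∣ + collessMB b + collessMB a
collessMB-join-comm a b = trans (xy∙z≈xz∙y ∣ a - b ∣ (collessMB a) (collessMB b))
  (cong (λ d → d + collessMB b + collessMB a) (∣-∣-comm a b))

collessMB-join : ∀ {a b} → 1 ≤ a → 1 ≤ b → ∣ a - b ∣ ≤ 1 →
  collessMB (a + b) ≡ ∣ a - b ∣ + collessMB a + collessMB b
collessMB-join {a} {b} 1≤a 1≤b d≤1 with ∣m-n∣≤1⇒m≡n⊎m≡1+n⊎n≡1+m a b d≤1
... | inj₁ refl        = collessMB-join-equal 1≤a
... | inj₂ (inj₁ refl) = collessMB-join-suc 1≤b
... | inj₂ (inj₂ refl) = begin
  collessMB (a + suc a)                           ≡⟨ cong collessMB (+-comm a (suc a)) ⟩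
  collessMB (suc a + a)                           ≡⟨ collessMB-join-suc 1≤a ⟩
  ∣ suc a - a ∣ + collessMB (suc a) + collessMB a ≡⟨ collessMB-join-comm (suc a) a ⟩
  ∣ a - suc a ∣ + collessMB a + collessMB (suc a) ∎
  where open ≡-Reasoning

collessMB-halves : ∀ {i p} → i ≤ 1 → 1 ≤ p →
  collessMB (i + p + p) ≡ i + collessMB (i + p) + collessMB p
collessMB-halves {i} {p} i≤1 1≤p = begin
  collessMB (i + p + p)
    ≡⟨ collessMB-join (≤-trans 1≤p (m≤n+m p i)) 1≤p d≤1 ⟩
  ∣ i + p - p ∣ + collessMB (i + p) + collessMB p
    ≡⟨ cong (λ d → d + collessMB (i + p) + collessMB p) (∣i+n-n∣≡i i p) ⟩
  i + collessMB (i + p) + collessMB p               ∎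
  where
  open ≡-Reasoning
  d≤1 : ∣ i + p - p ∣ ≤ 1
  d≤1 = subst (_≤ 1) (sym (∣i+n-n∣≡i i p)) i≤1

∣-∣-halves : ∀ {i j} p q → i ≤ 1 → j ≤ 1 →
  ∣ i - j ∣ + ∣ i + p - q ∣ + ∣ p - j + q ∣ ≤ ∣ i + p + p - j + q + q ∣ + i + j
∣-∣-halves p q z≤n z≤n = ≤-reflexive (begin
  ∣ p - q ∣ + ∣ p - q ∣       ≡⟨ ∣m+m-n+n∣≡∣m-n∣+∣m-n∣ p q ⟨
  ∣ p + p - q + q ∣           ≡⟨ trans (+-identityʳ _) (+-identityʳ _) ⟨
  ∣ p + p - q + q ∣ + 0 + 0   ∎)
  where open ≡-Reasoning
∣-∣-halves p q (s≤s z≤n) z≤n = ≤-reflexive (begin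
  suc (∣ suc p - q ∣ + ∣ p - q ∣) ≡⟨ cong suc (∣1+m+m-n+n∣≡∣1+m-n∣+∣m-n∣ p q) ⟨
  suc ∣ suc (p + p) - q + q ∣     ≡⟨ trans (+-identityʳ _) (+-comm _ 1) ⟨
  ∣ suc (p + p) - q + q ∣ + 1 + 0 ∎)
  where open ≡-Reasoning
∣-∣-halves p q z≤n (s≤s z≤n) = ≤-reflexive (begin
  suc (∣ p - q ∣ + ∣ p - suc q ∣) ≡⟨ cong suc (cong₂ _+_ (∣-∣-comm p q) (∣-∣-comm p (suc q))) ⟩
  suc (∣ q - p ∣ + ∣ suc q - p ∣) ≡⟨ cong suc (+-comm ∣ q - p ∣ _) ⟩
  suc (∣ suc q - p ∣ + ∣ q - p ∣) ≡⟨ cong suc (∣1+m+m-n+n∣≡∣1+m-n∣+∣m-n∣ q p) ⟨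
  suc ∣ suc (q + q) - p + p ∣     ≡⟨ cong suc (∣-∣-comm (suc (q + q)) (p + p)) ⟩
  suc ∣ p + p - suc (q + q) ∣     ≡⟨ trans (cong (_+ 1) (+-identityʳ _)) (+-comm _ 1) ⟨
  ∣ p + p - suc (q + q) ∣ + 0 + 1 ∎)
  where open ≡-Reasoning
∣-∣-halves p q (s≤s z≤n) (s≤s z≤n) = begin
  ∣ suc p - q ∣ + ∣ p - suc q ∣
    ≤⟨ +-mono-≤ (∣-∣-triangle (suc p) p q) (∣-∣-triangle p q (suc q)) ⟩
  (∣ suc p - p ∣ + d) + (d + ∣ q - suc q ∣)
    ≡⟨ cong₂ (λ x y → (x + d) + (d + y))
         (∣i+n-n∣≡i 1 p) (trans (∣-∣-comm q (suc q)) (∣i+n-n∣≡i 1 q)) ⟩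
  suc (d + (d + 1))
    ≡⟨ cong suc (trans (+-comm 1 (d + d)) (+-assoc d d 1)) ⟨
  suc (suc (d + d))
    ≡⟨ cong (λ x → suc (suc x)) (∣m+m-n+n∣≡∣m-n∣+∣m-n∣ p q) ⟨
  suc (suc ∣ p + p - q + q ∣)
    ≡⟨ trans (+-assoc _ 1 1) (+-comm _ 2) ⟨
  ∣ p + p - q + q ∣ + 1 + 1 ∎
  where
  open ≤-Reasoning
  d = ∣ p - q ∣

∣-∣-one : ∀ {j} q → j ≤ 1 → 1 ≤ q → ∣ suc q - j + q ∣ + ∣ 1 - q ∣ ≤ ∣ 1 - j + q + q ∣ + j
∣-∣-one (suc q) z≤n _ = begin
  ∣ suc q - q ∣ + q   ≡⟨ cong (_+ q) (∣i+n-n∣≡i 1 q) ⟩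
  suc q               ≤⟨ m≤n+m (suc q) q ⟩
  q + suc q           ≡⟨ +-identityʳ _ ⟨
  q + suc q + 0       ∎
  where open ≤-Reasoning
∣-∣-one (suc q) (s≤s z≤n) _ = begin
  ∣ q - q ∣ + q               ≡⟨ cong (_+ q) (∣n-n∣≡0 q) ⟩
  q                           ≤⟨ n≤1+n q ⟩
  suc q                       ≤⟨ m≤m+n (suc q) _ ⟩
  suc q + (suc q + 1)         ≡⟨ +-assoc (suc q) (suc q) 1 ⟨
  suc q + suc q + 1           ∎
  where open ≤-Reasoning

JoinBound : ℕ → ℕ → Set
JoinBound a b = collessMB (a + b) ≤ ∣ a - b ∣ + collessMB a + collessMB b

joinBound-comm : ∀ {a b} → JoinBound a b → JoinBound b a
joinBound-comm {a} {b} = subst₂ _≤_ (cong collessMB (+-comm a b)) (collessMB-join-comm a b)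

joinBound-zeroˡ : ∀ b → JoinBound 0 b
joinBound-zeroˡ b = begin
  collessMB b                      ≤⟨ m≤n+m _ b ⟩
  b + collessMB b                  ≡⟨ cong (_+ collessMB b) (+-identityʳ b) ⟨
  b + 0 + collessMB b              ≡⟨ cong (λ c → b + c + collessMB b) collessMB-zero ⟨
  b + collessMB 0 + collessMB b    ∎
  where open ≤-Reasoning

-- c 1 = 0 breaks the halving identity c (1 + 0 + 0) = 1 + c 1 + c 0, so a single leaf is
-- joined to the smaller half of b instead.
joinBound-one : ∀ {j q} → j ≤ 1 → 1 ≤ q → JoinBound 1 q → JoinBound 1 (j + q + q)
joinBound-one {j} {q} j≤1 1≤q one-q = begin
  c (1 + (j + q + q))
    ≡⟨ cong c (split j q) ⟩
  c (suc q + (j + q))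
    ≡⟨ collessMB-join (s≤s z≤n) (≤-trans 1≤q (m≤n+m q j)) parts≤1 ⟩
  ∣ suc q - j + q ∣ + c (suc q) + c (j + q)
    ≤⟨ +-monoˡ-≤ (c (j + q)) (+-monoʳ-≤ ∣ suc q - j + q ∣ one-q) ⟩
  ∣ suc q - j + q ∣ + (∣ 1 - q ∣ + c 1 + c q) + c (j + q)
    ≡⟨ shuffle ∣ suc q - j + q ∣ ∣ 1 - q ∣ (c 1) (c q) (c (j + q)) ⟩
  (∣ suc q - j + q ∣ + ∣ 1 - q ∣) + c 1 + (c (j + q) + c q)
    ≤⟨ +-monoˡ-≤ _ (+-monoˡ-≤ (c 1) (∣-∣-one q j≤1 1≤q)) ⟩
  (∣ 1 - j + q + q ∣ + j) + c 1 + (c (j + q) + c q)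
    ≡⟨ unshuffle ∣ 1 - j + q + q ∣ j (c 1) (c (j + q)) (c q) ⟩
  ∣ 1 - j + q + q ∣ + c 1 + (j + c (j + q) + c q)
    ≡⟨ cong (∣ 1 - j + q + q ∣ + c 1 +_) (collessMB-halves j≤1 1≤q) ⟨
  ∣ 1 - j + q + q ∣ + c 1 + c (j + q + q) ∎
  where
  open ≤-Reasoning
  c = collessMB
  split : ∀ j q → 1 + (j + q + q) ≡ suc q + (j + q)
  split = solve-∀
  parts≤1 : ∣ suc q - j + q ∣ ≤ 1
  parts≤1 = subst (_≤ 1) (sym (∣i+m-j+m∣≡∣i-j∣ 1 j q)) (∣i-j∣≤1 (s≤s z≤n) j≤1)
  shuffle : ∀ x y a b d → x + (y + a + b) + d ≡ (x + y) + a + (d + b)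
  shuffle = solve-∀
  unshuffle : ∀ x j a d b → (x + j) + a + (d + b) ≡ x + a + (j + d + b)
  unshuffle = solve-∀

joinBound-halves : ∀ {i j p q} → i ≤ 1 → j ≤ 1 → 1 ≤ p → 1 ≤ q →
  JoinBound (i + p) q → JoinBound p (j + q) → JoinBound (i + p + p) (j + q + q)
joinBound-halves {i} {j} {p} {q} i≤1 j≤1 1≤p 1≤q left right = begin
  c (i + p + p + (j + q + q))
    ≡⟨ cong c (split i j p q) ⟩
  c (i + p + q + (p + (j + q)))
    ≡⟨ collessMB-join (≤-trans 1≤q (m≤n+m q (i + p))) (≤-trans 1≤p (m≤m+n p (j + q))) parts≤1 ⟩
  ∣ i + p + q - p + (j + q) ∣ + c (i + p + q) + c (p + (j + q))
    ≤⟨ +-mono-≤ (+-mono-≤ (≤-reflexive parts-distance) left) right ⟩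
  ∣ i - j ∣ + (∣ i + p - q ∣ + c (i + p) + c q) + (∣ p - j + q ∣ + c p + c (j + q))
    ≡⟨ shuffle ∣ i - j ∣ ∣ i + p - q ∣ ∣ p - j + q ∣ (c (i + p)) (c q) (c p) (c (j + q)) ⟩
  (∣ i - j ∣ + ∣ i + p - q ∣ + ∣ p - j + q ∣) + (c (i + p) + c p) + (c (j + q) + c q)
    ≤⟨ +-monoˡ-≤ _ (+-monoˡ-≤ _ (∣-∣-halves p q i≤1 j≤1)) ⟩
  (Δ + i + j) + (c (i + p) + c p) + (c (j + q) + c q)
    ≡⟨ unshuffle Δ i j (c (i + p)) (c p) (c (j + q)) (c q) ⟩
  Δ + (i + c (i + p) + c p) + (j + c (j + q) + c q)
    ≡⟨ cong₂ (λ x y → Δ + x + y) (collessMB-halves i≤1 1≤p) (collessMB-halves j≤1 1≤q) ⟨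
  Δ + c (i + p + p) + c (j + q + q) ∎
  where
  open ≤-Reasoning
  c = collessMB
  Δ = ∣ i + p + p - j + q + q ∣
  split : ∀ i j p q → i + p + p + (j + q + q) ≡ i + p + q + (p + (j + q))
  split = solve-∀
  parts-distance : ∣ i + p + q - p + (j + q) ∣ ≡ ∣ i - j ∣
  parts-distance =
    trans (cong₂ ∣_-_∣ (+-assoc i p q) (x∙yz≈y∙xz p j q)) (∣i+m-j+m∣≡∣i-j∣ i j (p + q))
  parts≤1 : ∣ i + p + q - p + (j + q) ∣ ≤ 1
  parts≤1 = subst (_≤ 1) (sym parts-distance) (∣i-j∣≤1 i≤1 j≤1)
  shuffle : ∀ x y z a b d e → x + (y + a + b) + (z + d + e) ≡ (x + y + z) + (a + d) + (e + b)
  shuffle = solve-∀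
  unshuffle : ∀ x i j a d e b → (x + i + j) + (a + d) + (e + b) ≡ x + (i + a + d) + (j + e + b)
  unshuffle = solve-∀

n<i+n+n : ∀ i {n} → 1 ≤ n → n < i + n + n
n<i+n+n i {n} 1≤n = m<n+m n (≤-trans 1≤n (m≤n+m n i))

data Halves : ℕ → Set where
  halves : ∀ i p → i ≤ 1 → Halves (i + p + p)

halve : ∀ n → Halves n
halve zero = halves 0 0 z≤n
halve (suc n) with halve n
... | halves _ p z≤n       = halves 1 p (s≤s z≤n)
... | halves _ p (s≤s z≤n) = subst Halves (cong suc (+-suc p p)) (halves 0 (suc p) z≤n)

joinBound-step : ∀ a b → (∀ {a′ b′} → a′ + b′ < a + b → JoinBound a′ b′) → JoinBound a b
joinBound-step a b smaller with halve a | halve b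
... | halves _ 0 z≤n         | _                      = joinBound-zeroˡ b
... | _                      | halves _ 0 z≤n         = joinBound-comm (joinBound-zeroˡ a)
... | halves _ 0 (s≤s z≤n)   | halves _ 0 (s≤s z≤n)   =
  ≤-reflexive (collessMB-join {1} {1} (s≤s z≤n) (s≤s z≤n) z≤n)
... | halves _ 0 (s≤s z≤n)   | halves j (suc q) j≤1   =
  joinBound-one j≤1 (s≤s z≤n) (smaller (s≤s (n<i+n+n j (s≤s z≤n))))
... | halves i (suc p) i≤1   | halves _ 0 (s≤s z≤n)   =
  joinBound-comm (joinBound-one i≤1 (s≤s z≤n)
    (joinBound-comm (smaller (+-monoˡ-< 1 (n<i+n+n i (s≤s z≤n))))))
... | halves i (suc p) i≤1   | halves j (suc q) j≤1   = joinBound-halves i≤1 j≤1 (s≤s z≤n) (s≤s z≤n)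
  (smaller (+-mono-< (m<m+n (i + suc p) z<s) (n<i+n+n j (s≤s z≤n))))
  (smaller (+-mono-< (n<i+n+n i (s≤s z≤n)) (m<m+n (j + suc q) z<s)))

joinBound : ∀ a b → JoinBound a b
joinBound a b = <-rec JoinBoundWithSum step (a + b) a b refl
  where
  JoinBoundWithSum : ℕ → Set
  JoinBoundWithSum n = ∀ a b → a + b ≡ n → JoinBound a b
  step : ∀ n → (∀ {m} → m < n → JoinBoundWithSum m) → JoinBoundWithSum n
  step _ rec a b refl = joinBound-step a b (λ lt → rec lt _ _ refl)

∣m⊖n∣≡∣m-n∣ : ∀ m n → ℤ.∣ m ℤ.⊖ n ∣ ≡ ∣ m - n ∣
∣m⊖n∣≡∣m-n∣ zero    zero    = refl
∣m⊖n∣≡∣m-n∣ zero    (suc n) = refl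
∣m⊖n∣≡∣m-n∣ (suc m) zero    = refl
∣m⊖n∣≡∣m-n∣ (suc m) (suc n) = trans (cong ℤ.∣_∣ (ℤ.[1+m]⊖[1+n]≡m⊖n m n)) (∣m⊖n∣≡∣m-n∣ m n)

bal≡∣leaves-leaves∣ : ∀ l r → bal l r ≡ ∣ leaves l - leaves r ∣
bal≡∣leaves-leaves∣ l r =
  trans (cong ℤ.∣_∣ (ℤ.[+m]-[+n]≡m⊖n (leaves l) (leaves r))) (∣m⊖n∣≡∣m-n∣ (leaves l) (leaves r))

1≤leaves : ∀ T → 1 ≤ leaves T
1≤leaves leaf       = s≤s z≤n
1≤leaves (node l r) = ≤-trans (1≤leaves l) (m≤m+n (leaves l) (leaves r))

collessMB≤colless : ∀ T → collessMB (leaves T) ≤ colless T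
collessMB≤colless leaf       = ≤-reflexive (collessMB-unfold 1)
collessMB≤colless (node l r) = begin
  collessMB (leaves l + leaves r)
    ≤⟨ joinBound (leaves l) (leaves r) ⟩
  ∣ leaves l - leaves r ∣ + collessMB (leaves l) + collessMB (leaves r)
    ≤⟨ +-mono-≤ (+-mono-≤ (≤-reflexive (sym (bal≡∣leaves-leaves∣ l r))) (collessMB≤colless l))
                (collessMB≤colless r) ⟩
  bal l r + colless l + colless r ∎
  where open ≤-Reasoning

colless≡collessMB : ∀ {T} → MaxBal T → colless T ≡ collessMB (leaves T)
colless≡collessMB mb-leaf = sym (collessMB-unfold 1)
colless≡collessMB {node l r} (mb-node bal≤1 mb-l mb-r) = begin
  bal l r + colless l + colless r
    ≡⟨ cong₂ _+_ (cong₂ _+_ (bal≡∣leaves-leaves∣ l r) (colless≡collessMB mb-l))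
                 (colless≡collessMB mb-r) ⟩
  ∣ leaves l - leaves r ∣ + collessMB (leaves l) + collessMB (leaves r)
    ≡⟨ collessMB-join (1≤leaves l) (1≤leaves r) (subst (_≤ 1) (bal≡∣leaves-leaves∣ l r) bal≤1) ⟨
  collessMB (leaves l + leaves r) ∎
  where open ≡-Reasoning

theorem4 : ∀ (n : ℕ) → 1 ≤ n → ∀ (T : Tree) → leaves T ≡ n → MaxBal T → MinColless n T
theorem4 _ _ T refl mb = refl , λ T′ leaves≡ → begin
  colless T               ≡⟨ colless≡collessMB mb ⟩
  collessMB (leaves T)    ≡⟨ cong collessMB leaves≡ ⟨
  collessMB (leaves T′)   ≤⟨ collessMB≤colless T′ ⟩
  colless T′              ∎
  where open ≤-Reasoning
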